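{- Let $Q$ be a quiver (finite, without loops and multiple edges) and let $R$ be a lluf subquiver of $Q$ with $\dim(\operatorname{DE}(R))=\dim(\operatorname{DE}(Q))-1$. Then $\operatorname{DE}(R)$ is a facet of $\operatorname{DE}(Q)$ if and only if one of the following holds: (1) $\#\pi_0(R)=\#\pi_0(Q)+1$, each connected component of $R$ is a full subquiver of $Q$, and the contraction $Q/R$ is acyclic; (2) $\#\pi_0(R)=\#\pi_0(Q)$ and there exists a rank function $\rho$ of $R$ such that $(\rho(v)-\rho(w)+1)(\rho(v')-\rho(w')+1)>0$ for all $(v,w),(v',w')\in Q_1\setminus R_1$.
   Context: A quiver is a pair $Q=(Q_0,Q_1)$ with $Q_0$ a finite set and $Q_1\subset (Q_0\times Q_0)\setminus\{(v,v)\mid v\in Q_0\}$. For $v\in Q_0$ let $\kappa_{\{v\}}\in\mathbb{R}^{Q_0}$ be the indicator function of $v$, and $\varepsilon_{(v,w)}=\kappa_{\{v\}}-\kappa_{\{w\}}$. The directed edge polytope is $\operatorname{DE}(Q)=\operatorname{conv}\{\varepsilon_{(v,w)}\mid (v,w)\in Q_1\}\subset\mathbb{R}^{Q_0}$. A subquiver $R$ of $Q$ has $R_0\subset Q_0$, $R_1\subset Q_1$; it is lluf if $R_0=Q_0$, and full if $R_1=\{(v,w)\in Q_1\mid v,w\in R_0\}$. An undirected walk is a sequence $(v_0,\dots,v_n)$ with $(v_t,v_{t+1})\in Q_1$ or $(v_{t+1},v_t)\in Q_1$ for all $t$; connectivity and the set $\pi_0(Q)$ of connected components are defined via undirected walks.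 A quiver is acyclic if it has no directed cycle, i.e.\ no $v_0,\dots,v_n$ with $n>1$, $v_n=v_0$, $(v_t,v_{t+1})\in Q_1$ for all $t$. A rank function of $R$ is $\rho:R_0\to\mathbb{R}$ with $\rho(v)+1=\rho(w)$ for each $(v,w)\in R_1$. Contraction: if each connected component of $R$ is full in $Q$, let $\sim$ be the equivalence relation on $Q_0$ with $v\sim w$ iff $v,w$ are joined by an undirected walk in $R$, with classes $[v]$; then $Q/R$ is the quiver with vertex set $Q_0/\sim$ and edge set $\{([v],[w])\mid (v,w)\in Q_1\setminus R_1\}$.
   Formalization: Points of the polytopes have rational coordinates, and the convex-combination and affine-dependence coefficients, the supporting functionals of faces, and the rank function ρ take values in ℚ instead of ℝ. -}

module Defs where

open import Data.Bool using (Bool; true; false; T; if_then_else_)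
open import Data.Nat using (ℕ; suc; _≤_)
open import Data.Fin using (Fin)
open import Data.Fin.Properties using () renaming (_≟_ to _≟ᶠ_)
open import Data.List using (List; []; _∷_; foldr; map; length; zipWith; allFin)
open import Data.List.Relation.Unary.All using (All)
open import Data.Product using (Σ; ∃; _×_; _,_)
open import Data.Sum using (_⊎_)
open import Relation.Nullary using (¬_; does)
open import Relation.Binary.PropositionalEquality using (_≡_)
open import Function.Bundles using (_⇔_)
open import Function.Definitions using (Surjective)
open import Data.Rational as ℚ using (ℚ; 0ℚ; 1ℚ)
open import Data.Integer as ℤ using (ℤ; +_; 1ℤ)

-- Quivers on the vertex set Fin n (finite, no loops, no multiple edges)

record Quiver (n : ℕ) : Set where
  field
    edge   : Fin n → Fin n → Bool
    noLoop : ∀ v → edge v v ≡ false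
open Quiver public

Edge : ∀ {n} → Quiver n → Fin n → Fin n → Set
Edge Q v w = T (edge Q v w)

LlufSubquiver : ∀ {n} → Quiver n → Quiver n → Set
LlufSubquiver {n} R Q = ∀ (v w : Fin n) → Edge R v w → Edge Q v w

data Walk {n} (Q : Quiver n) : Fin n → Fin n → Set where
  here : ∀ {v} → Walk Q v v
  fwd  : ∀ {v u w} → Edge Q v u → Walk Q u w → Walk Q v w
  bwd  : ∀ {v u w} → Edge Q u v → Walk Q u w → Walk Q v w

Connected : ∀ {n} → Quiver n → Fin n → Fin n → Set
Connected Q v w = Walk Q v w

-- #π₀(Q) = k : there is a surjection Fin n → Fin k whose fibres are
-- exactly the connected components.
NumComponents : ∀ {n} → Quiver n → ℕ → Set
NumComponents {n} Q k =
  Σ (Fin n → Fin k) λ comp →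
    Surjective _≡_ _≡_ comp ×
    (∀ v w → (comp v ≡ comp w) ⇔ Connected Q v w)

ComponentsFull : ∀ {n} → Quiver n → Quiver n → Set
ComponentsFull {n} Q R =
  ∀ (v w : Fin n) → Edge Q v w → Connected R v w → Edge R v w

-- The contraction Q/R, presented on representatives: the vertex [a]
-- is the class of a under "Connected R", and ([a],[b]) is an edge iff
-- there is (v,w) ∈ Q₁ ∖ R₁ with v ~ a and w ~ b.

ContrEdge : ∀ {n} → Quiver n → Quiver n → Fin n → Fin n → Set
ContrEdge {n} Q R a b =
  Σ (Fin n) λ v → Σ (Fin n) λ w →
    Edge Q v w × ¬ Edge R v w × Connected R a v × Connected R w b

data ContrPath {n} (Q R : Quiver n) : Fin n → Fin n → ℕ → Set where
  stop : ∀ {a} → ContrPath Q R a a 0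
  step : ∀ {a b c m} → ContrEdge Q R a b → ContrPath Q R b c m →
         ContrPath Q R a c (suc m)

ContractionAcyclic : ∀ {n} → Quiver n → Quiver n → Set
ContractionAcyclic {n} Q R =
  ∀ (a b : Fin n) (m : ℕ) → 2 ≤ m → ContrPath Q R a b m → ¬ Connected R b a

IsRankFunction : ∀ {n} → Quiver n → (Fin n → ℚ) → Set
IsRankFunction {n} R ρ = ∀ (v w : Fin n) → Edge R v w → ρ v ℚ.+ 1ℚ ≡ ρ w

Pt : ℕ → Set
Pt n = Fin n → ℚ

sumℚ : List ℚ → ℚ
sumℚ = foldr ℚ._+_ 0ℚ

κ : ∀ {n} → Fin n → Pt n
κ v u = if does (v ≟ᶠ u) then 1ℚ else 0ℚ

ε : ∀ {n} → Fin n → Fin n → Pt n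
ε v w u = κ v u ℚ.- κ w u

dot : ∀ {n} → Pt n → Pt n → ℚ
dot {n} c x = sumℚ (map (λ u → c u ℚ.* x u) (allFin n))

record WEdge (n : ℕ) : Set where
  constructor w[_,_,_]
  field
    coeff : ℚ
    src   : Fin n
    tgt   : Fin n

DE : ∀ {n} → Quiver n → Pt n → Set
DE {n} Q x =
  Σ (List (WEdge n)) λ ws →
    All (λ e → 0ℚ ℚ.≤ WEdge.coeff e × Edge Q (WEdge.src e) (WEdge.tgt e)) ws ×
    sumℚ (map WEdge.coeff ws) ≡ 1ℚ ×
    (∀ u → x u ≡ sumℚ (map (λ e → WEdge.coeff e ℚ.* ε (WEdge.src e) (WEdge.tgt e) u) ws))

AffinelyIndependent : ∀ {n} → List (Pt n) → Set
AffinelyIndependent ps =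
  ∀ (ls : List ℚ) → length ls ≡ length ps → sumℚ ls ≡ 0ℚ →
    (∀ u → sumℚ (zipWith (λ l p → l ℚ.* p u) ls ps) ≡ 0ℚ) →
    All (_≡ 0ℚ) ls

-- dim S = d : the maximal number of affinely independent points of S is d + 1
-- (so dim ∅ = -1)
HasDim : ∀ {n} → (Pt n → Set) → ℤ → Set
HasDim {n} S d =
  (Σ (List (Pt n)) λ ps → All S ps × AffinelyIndependent ps × (+ length ps ≡ d ℤ.+ 1ℤ)) ×
  (∀ (ps : List (Pt n)) → All S ps → AffinelyIndependent ps → + length ps ℤ.≤ d ℤ.+ 1ℤ)

IsFace : ∀ {n} → (Pt n → Set) → (Pt n → Set) → Set
IsFace {n} F P =
  Σ (Pt n) λ c → Σ ℚ λ b →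
    (∀ x → P x → dot c x ℚ.≤ b) ×
    (∀ x → F x ⇔ (P x × dot c x ≡ b))

IsFacet : ∀ {n} → (Pt n → Set) → (Pt n → Set) → Set
IsFacet F P = IsFace F P × Σ ℤ λ d → HasDim P d × HasDim F (d ℤ.- 1ℤ)

-- The two conditions of the theorem (k = #π₀(Q), l = #π₀(R))

Condition1 : ∀ {n} → Quiver n → Quiver n → ℕ → ℕ → Set
Condition1 Q R k l = l ≡ suc k × ComponentsFull Q R × ContractionAcyclic Q R

Condition2 : ∀ {n} → Quiver n → Quiver n → ℕ → ℕ → Set
Condition2 {n} Q R k l =
  l ≡ k ×
  Σ (Fin n → ℚ) λ ρ → IsRankFunction R ρ ×
    (∀ (v w v' w' : Fin n) →
       Edge Q v w → ¬ Edge R v w → Edge Q v' w' → ¬ Edge R v' w' →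
       0ℚ ℚ.< (ρ v ℚ.- ρ w ℚ.+ 1ℚ) ℚ.* (ρ v' ℚ.- ρ w' ℚ.+ 1ℚ))

-- A valid inequality ⟨c , -⟩ ≤ b of DE(Q) cuts out the hull of those edges (s , t) whose slack
-- b - (c(s) - c(t)) vanishes, and each ε s t is a vertex; so DE(R) is a face iff some (c , b) has
-- zero slack exactly on the edges of R. If dim DE(R) = dim DE(Q) - 1, every functional g vanishing
-- on DE(R) is rigid: g(ε e) · slack(f) = g(ε f) · slack(e) for all edges e, f of Q, since otherwise
-- ε e and ε f would extend a maximal independent family of DE(R). Taking g the indicator of a
-- component of R shows: if one edge of Q ∖ R joins two components [v] → [w], then all of them do,
-- which gives condition (1); otherwise b ≠ 0 and ρ = - c / b is a rank function of R whose defects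
-- ρ(s) - ρ(t) + 1 on Q ∖ R all have the sign of b, which is condition (2). Conversely the indicator
-- of [w] (with b = 0), respectively a multiple of - ρ, cuts out DE(R).

module Submission where

open import Defs
open import Data.Nat using (ℕ)
open import Data.Product using (Σ; _×_)
open import Data.Sum using (_⊎_)
open import Function.Bundles using (_⇔_)
open import Data.Integer as ℤ using (ℤ; 1ℤ)

open import Algebra.Bundles using (CommutativeRing)
import Algebra.Properties.Group as GroupProperties
open import Data.Bool using (T; if_then_else_)
open import Data.Bool.Properties using (T?)
open import Data.Fin using (Fin; zero; suc; punchIn; punchOut)
import Data.Fin.Properties as FinP
import Data.Integer.Properties as ℤP
open import Data.List using (List; []; _∷_; map; tabulate; filter; zipWith; length)
open import Data.List.Relation.Unary.All as All using (All; []; _∷_)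
import Data.List.Relation.Unary.All.Properties as AllP
import Data.Nat as ℕ
import Data.Nat.Properties as ℕP
open import Data.Product using (∃₂; _,_; proj₁; proj₂)
open import Data.Rational as ℚ using (ℚ; 0ℚ; 1ℚ; _+_; _*_; _-_; -_; _≤_; _<_; 1/_)
import Data.Rational.Properties as ℚP
open import Data.Rational.Solver using (module +-*-Solver)
open import Data.Sum using (inj₁; inj₂; [_,_]′)
open import Function.Base using (_∘_)
open import Function.Bundles using (Equivalence; mk⇔)
open import Function.Definitions using (Injective; Surjective)
open import Relation.Binary.Definitions using (tri<; tri≈; tri>)
open import Relation.Binary.PropositionalEquality hiding ([_])
open import Relation.Nullary using (¬_; ¬?; Dec; yes; no; _×-dec_; contradiction)
open import Relation.Nullary.Decidable using (dec-true; dec-false)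
open import Relation.Unary using (Decidable)

open import Algebra.Properties.Semiring.Sum (CommutativeRing.semiring ℚP.+-*-commutativeRing)
  using (sum; sum-cong-≗; sum-remove; sum-replicate-zero; ∑-distrib-+; *-distribˡ-sum)
open +-*-Solver
module ℚ+ = GroupProperties ℚP.+-0-group

private variable
  n : ℕ
  p q : ℚ
  A : Set

-- Arithmetic in ℚ

≤∧≢⇒< : p ≤ q → p ≢ q → p < q
≤∧≢⇒< {p} {q} p≤q p≢q with ℚP.<-cmp p q
... | tri< p<q _ _ = p<q
... | tri≈ _ p≡q _ = contradiction p≡q p≢q
... | tri> _ _ q<p = contradiction (ℚP.<-≤-trans q<p p≤q) (ℚP.<-irrefl refl)

p≤q⇒0≤q-p : p ≤ q → 0ℚ ≤ q - p
p≤q⇒0≤q-p {p} {q} p≤q = subst (_≤ q - p) (ℚP.+-inverseʳ p) (ℚP.+-monoˡ-≤ (- p) p≤q)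

0≤q-p⇒p≤q : 0ℚ ≤ q - p → p ≤ q
0≤q-p⇒p≤q {q} {p} 0≤q-p =
  subst₂ _≤_ (ℚP.+-identityʳ p) (solve 2 (λ p q → p :+ (q :- p) := q) refl p q) (ℚP.+-monoʳ-≤ p 0≤q-p)

*-cancelʳ-≡0 : q ≢ 0ℚ → p * q ≡ 0ℚ → p ≡ 0ℚ
*-cancelʳ-≡0 {q} {p} q≢0 pq≡0 = begin
  p                ≡⟨ ℚP.*-identityʳ p ⟨
  p * 1ℚ           ≡⟨ cong (p *_) (ℚP.*-inverseʳ q) ⟨
  p * (q * 1/ q)   ≡⟨ ℚP.*-assoc p q (1/ q) ⟨
  p * q * 1/ q     ≡⟨ cong (_* 1/ q) pq≡0 ⟩
  0ℚ * 1/ q        ≡⟨ ℚP.*-zeroˡ (1/ q) ⟩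
  0ℚ               ∎
  where
  open ≡-Reasoning
  instance _ = ℚ.≢-nonZero q≢0

pos*pos : 0ℚ < p → 0ℚ < q → 0ℚ < p * q
pos*pos {p} {q} 0<p 0<q =
  ℚP.positive⁻¹ (p * q) {{ℚP.pos*pos⇒pos p {{ℚ.positive 0<p}} q {{ℚ.positive 0<q}}}}

nonNeg*nonNeg : 0ℚ ≤ p → 0ℚ ≤ q → 0ℚ ≤ p * q
nonNeg*nonNeg {p} {q} 0≤p 0≤q =
  ℚP.nonNegative⁻¹ (p * q) {{ℚP.nonNeg*nonNeg⇒nonNeg p {{ℚ.nonNegative 0≤p}} q {{ℚ.nonNegative 0≤q}}}}

pos-factor : 0ℚ < q → 0ℚ < p * q → 0ℚ < p
pos-factor {q} {p} 0<q 0<pq =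
  ℚP.*-cancelʳ-<-nonNeg q {{ℚ.nonNegative (ℚP.<⇒≤ 0<q)}} (subst (_< p * q) (sym (ℚP.*-zeroˡ q)) 0<pq)

neg-factor : 0ℚ < q → p * q < 0ℚ → p < 0ℚ
neg-factor {q} {p} 0<q pq<0 =
  ℚP.*-cancelʳ-<-nonNeg q {{ℚ.nonNegative (ℚP.<⇒≤ 0<q)}} (subst (p * q <_) (sym (ℚP.*-zeroˡ q)) pq<0)

square-pos : p ≢ 0ℚ → 0ℚ < p * p
square-pos {p} p≢0 with ℚP.<-cmp p 0ℚ
... | tri< p<0 _ _ = ℚP.positive⁻¹ (p * p) {{ℚP.neg*neg⇒pos p {{ℚ.negative p<0}} p {{ℚ.negative p<0}}}}
... | tri≈ _ p≡0 _ = contradiction p≡0 p≢0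
... | tri> _ _ 0<p = pos*pos 0<p 0<p

-- The pairing dot and edge vectors

sumℚ-map-tabulate : ∀ {m} (f : Fin m → A) (h : A → ℚ) → sumℚ (map h (tabulate f)) ≡ sum (h ∘ f)
sumℚ-map-tabulate {m = ℕ.zero}  f h = refl
sumℚ-map-tabulate {m = ℕ.suc m} f h = cong (h (f zero) +_) (sumℚ-map-tabulate (f ∘ suc) h)

dot-sum : (c x : Pt n) → dot c x ≡ sum (λ u → c u * x u)
dot-sum c x = sumℚ-map-tabulate (λ u → u) (λ u → c u * x u)

module _ (c : Pt n) where

  dot-cong : {x y : Pt n} → (∀ u → x u ≡ y u) → dot c x ≡ dot c y
  dot-cong {x} {y} x≗y =
    trans (dot-sum c x) (trans (sum-cong-≗ (λ u → cong (c u *_) (x≗y u))) (sym (dot-sum c y)))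

  dot-zero : dot c (λ _ → 0ℚ) ≡ 0ℚ
  dot-zero = begin
    dot c (λ _ → 0ℚ)              ≡⟨ dot-sum c _ ⟩
    sum (λ u → c u * 0ℚ)          ≡⟨ sum-cong-≗ (λ u → trans (ℚP.*-zeroʳ (c u)) (sym (ℚP.*-zeroˡ (c u)))) ⟩
    sum (λ u → 0ℚ * c u)          ≡⟨ *-distribˡ-sum 0ℚ c ⟨
    0ℚ * sum c                    ≡⟨ ℚP.*-zeroˡ (sum c) ⟩
    0ℚ                            ∎
    where open ≡-Reasoning

  dot-+ : (x y : Pt n) → dot c (λ u → x u + y u) ≡ dot c x + dot c y
  dot-+ x y = begin
    dot c (λ u → x u + y u)                   ≡⟨ dot-sum c _ ⟩
    sum (λ u → c u * (x u + y u))             ≡⟨ sum-cong-≗ (λ u → ℚP.*-distribˡ-+ (c u) (x u) (y u)) ⟩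
    sum (λ u → c u * x u + c u * y u)         ≡⟨ ∑-distrib-+ (λ u → c u * x u) (λ u → c u * y u) ⟩
    sum (λ u → c u * x u) + sum (λ u → c u * y u) ≡⟨ cong₂ _+_ (dot-sum c x) (dot-sum c y) ⟨
    dot c x + dot c y                         ∎
    where open ≡-Reasoning

  dot-* : (a : ℚ) (x : Pt n) → dot c (λ u → a * x u) ≡ a * dot c x
  dot-* a x = begin
    dot c (λ u → a * x u)         ≡⟨ dot-sum c _ ⟩
    sum (λ u → c u * (a * x u))   ≡⟨ sum-cong-≗ (λ u → solve 3 (λ c a x → c :* (a :* x) := a :* (c :* x))
                                                             refl (c u) a (x u)) ⟩
    sum (λ u → a * (c u * x u))   ≡⟨ *-distribˡ-sum a (λ u → c u * x u) ⟨
    a * sum (λ u → c u * x u)     ≡⟨ cong (a *_) (dot-sum c x) ⟨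
    a * dot c x                   ∎
    where open ≡-Reasoning

κ-diag : (v : Fin n) → κ v v ≡ 1ℚ
κ-diag v = cong (λ b → if b then 1ℚ else 0ℚ) (dec-true (v FinP.≟ v) refl)

κ-off : {v u : Fin n} → v ≢ u → κ v u ≡ 0ℚ
κ-off {v = v} {u} v≢u = cong (λ b → if b then 1ℚ else 0ℚ) (dec-false (v FinP.≟ u) v≢u)

κ-cases : (v u : Fin n) → (v ≡ u × κ v u ≡ 1ℚ) ⊎ (v ≢ u × κ v u ≡ 0ℚ)
κ-cases v u with v FinP.≟ u
... | yes v≡u = inj₁ (v≡u , refl)
... | no v≢u  = inj₂ (v≢u , refl)

dot-κ : (c : Pt n) (v : Fin n) → dot c (κ v) ≡ c v
dot-κ {n = ℕ.suc n} c v = begin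
  dot c (κ v)                                                       ≡⟨ dot-sum c (κ v) ⟩
  sum (λ u → c u * κ v u)                                           ≡⟨ sum-remove {i = v} (λ u → c u * κ v u) ⟩
  c v * κ v v + sum (λ j → c (punchIn v j) * κ v (punchIn v j))     ≡⟨ cong₂ _+_ on-v off-v ⟩
  c v + 0ℚ                                                          ≡⟨ ℚP.+-identityʳ (c v) ⟩
  c v                                                               ∎
  where
  open ≡-Reasoning
  on-v : c v * κ v v ≡ c v
  on-v = trans (cong (c v *_) (κ-diag v)) (ℚP.*-identityʳ (c v))
  off-v : sum (λ j → c (punchIn v j) * κ v (punchIn v j)) ≡ 0ℚ
  off-v = trans (sum-cong-≗ λ j → trans (cong (c (punchIn v j) *_) (κ-off (FinP.punchInᵢ≢i v j ∘ sym)))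
                                        (ℚP.*-zeroʳ (c (punchIn v j))))
                (sum-replicate-zero n)

module _ (c : Pt n) where

  dot-neg : (x : Pt n) → dot c (λ u → - x u) ≡ - dot c x
  dot-neg x = begin
    dot c (λ u → - x u)          ≡⟨ dot-cong c (λ u → solve 1 (λ x → :- x := :- con 1ℚ :* x) refl (x u)) ⟩
    dot c (λ u → - 1ℚ * x u)     ≡⟨ dot-* c (- 1ℚ) x ⟩
    - 1ℚ * dot c x               ≡⟨ solve 1 (λ y → :- con 1ℚ :* y := :- y) refl (dot c x) ⟩
    - dot c x                    ∎
    where open ≡-Reasoning

  dot-ε : (v w : Fin n) → dot c (ε v w) ≡ c v - c w
  dot-ε v w = begin
    dot c (ε v w)                      ≡⟨ dot-+ c (κ v) (λ u → - κ w u) ⟩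
    dot c (κ v) + dot c (λ u → - κ w u) ≡⟨ cong₂ _+_ (dot-κ c v) (trans (dot-neg (κ w)) (cong -_ (dot-κ c w))) ⟩
    c v - c w                          ∎
    where open ≡-Reasoning

-- Convex hulls of edge vectors

Σₗ : (A → ℚ) → List A → ℚ
Σₗ f xs = sumℚ (map f xs)

module _ {f g : A → ℚ} where

  Σₗ-cong : {xs : List A} → All (λ x → f x ≡ g x) xs → Σₗ f xs ≡ Σₗ g xs
  Σₗ-cong []           = refl
  Σₗ-cong (fx≡gx ∷ eqs) = cong₂ _+_ fx≡gx (Σₗ-cong eqs)

  Σₗ-− : (xs : List A) → Σₗ (λ x → f x - g x) xs ≡ Σₗ f xs - Σₗ g xs
  Σₗ-− []       = refl
  Σₗ-− (x ∷ xs) = trans (cong (f x - g x +_) (Σₗ-− xs))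
    (solve 4 (λ a b c d → (a :- b) :+ (c :- d) := (a :+ c) :- (b :+ d)) refl (f x) (g x) (Σₗ f xs) (Σₗ g xs))

module _ {f : A → ℚ} where

  Σₗ-*ˡ : (a : ℚ) (xs : List A) → Σₗ (λ x → a * f x) xs ≡ a * Σₗ f xs
  Σₗ-*ˡ a []       = sym (ℚP.*-zeroʳ a)
  Σₗ-*ˡ a (x ∷ xs) = trans (cong (a * f x +_) (Σₗ-*ˡ a xs)) (sym (ℚP.*-distribˡ-+ a (f x) (Σₗ f xs)))

  Σₗ-zero : {xs : List A} → All (λ x → f x ≡ 0ℚ) xs → Σₗ f xs ≡ 0ℚ
  Σₗ-zero []             = refl
  Σₗ-zero (fx≡0 ∷ zeros) = trans (cong₂ _+_ fx≡0 (Σₗ-zero zeros)) (ℚP.+-identityʳ 0ℚ)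

  Σₗ-nonNeg : {xs : List A} → All (λ x → 0ℚ ≤ f x) xs → 0ℚ ≤ Σₗ f xs
  Σₗ-nonNeg []             = ℚP.≤-refl
  Σₗ-nonNeg (0≤fx ∷ 0≤fxs) = ℚP.+-mono-≤ 0≤fx (Σₗ-nonNeg 0≤fxs)

  Σₗ-nonNeg-≡0 : {xs : List A} → All (λ x → 0ℚ ≤ f x) xs → Σₗ f xs ≡ 0ℚ → All (λ x → f x ≡ 0ℚ) xs
  Σₗ-nonNeg-≡0 []                        _   = []
  Σₗ-nonNeg-≡0 {x ∷ xs} (0≤fx ∷ 0≤fxs) Σ≡0 = fx≡0 ∷ Σₗ-nonNeg-≡0 0≤fxs Σxs≡0
    where
    fx≤0 : f x ≤ 0ℚ
    fx≤0 = subst₂ _≤_ (ℚP.+-identityʳ (f x)) Σ≡0 (ℚP.+-monoʳ-≤ (f x) (Σₗ-nonNeg 0≤fxs))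
    fx≡0 : f x ≡ 0ℚ
    fx≡0 = ℚP.≤-antisym fx≤0 0≤fx
    Σxs≡0 : Σₗ f xs ≡ 0ℚ
    Σxs≡0 = trans (sym (ℚP.+-identityˡ (Σₗ f xs))) (trans (cong (_+ Σₗ f xs) (sym fx≡0)) Σ≡0)

  Σₗ-filter : {P : A → Set} (P? : Decidable P) {xs : List A} →
              All (λ x → ¬ P x → f x ≡ 0ℚ) xs → Σₗ f (filter P? xs) ≡ Σₗ f xs
  Σₗ-filter P? [] = refl
  Σₗ-filter P? {x ∷ xs} (dropped ∷ rest) with P? x
  ... | yes _  = cong (f x +_) (Σₗ-filter P? rest)
  ... | no ¬Px = trans (Σₗ-filter P? rest)
                       (sym (trans (cong (_+ Σₗ f xs) (dropped ¬Px)) (ℚP.+-identityˡ (Σₗ f xs))))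

dot-Σₗ : (c : Pt n) (a : A → ℚ) (p : A → Pt n) (xs : List A) →
         dot c (λ u → Σₗ (λ x → a x * p x u) xs) ≡ Σₗ (λ x → a x * dot c (p x)) xs
dot-Σₗ c a p []       = dot-zero c
dot-Σₗ c a p (x ∷ xs) = begin
  dot c (λ u → a x * p x u + Σₗ (λ y → a y * p y u) xs)
    ≡⟨ dot-+ c (λ u → a x * p x u) (λ u → Σₗ (λ y → a y * p y u) xs) ⟩
  dot c (λ u → a x * p x u) + dot c (λ u → Σₗ (λ y → a y * p y u) xs)
    ≡⟨ cong₂ _+_ (dot-* c (a x) (p x)) (dot-Σₗ c a p xs) ⟩
  a x * dot c (p x) + Σₗ (λ y → a y * dot c (p y)) xs ∎
  where open ≡-Reasoning

open WEdge

-- DE Q is Hull (Edge Q) by definition; general edge predicates allow restricting to tight edges.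
Hull : (Fin n → Fin n → Set) → Pt n → Set
Hull {n} P x =
  Σ (List (WEdge n)) λ ws →
    All (λ e → 0ℚ ≤ coeff e × P (src e) (tgt e)) ws ×
    Σₗ coeff ws ≡ 1ℚ ×
    (∀ u → x u ≡ Σₗ (λ e → coeff e * ε (src e) (tgt e) u) ws)

slack : Pt n → ℚ → Fin n → Fin n → ℚ
slack c b s t = b - (c s - c t)

private variable
  P P′ : Fin n → Fin n → Set
  x : Pt n

hull-mono : (∀ {s t} → P s t → P′ s t) → Hull P x → Hull P′ x
hull-mono P⇒P′ (ws , ok , Σ≡1 , x≗) = ws , All.map (λ (0≤a , Pe) → 0≤a , P⇒P′ Pe) ok , Σ≡1 , x≗

ε∈hull : {v w : Fin n} → P v w → Hull P (ε v w)
ε∈hull {v = v} {w} Pvw =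
  w[ 1ℚ , v , w ] ∷ [] , (ℚP.nonNegative⁻¹ 1ℚ , Pvw) ∷ [] , refl ,
  λ u → sym (trans (ℚP.+-identityʳ _) (ℚP.*-identityˡ _))

hull-inhabited : Hull P x → ∃₂ P
hull-inhabited ([] , [] , () , _)
hull-inhabited (e ∷ _ , (_ , Pe) ∷ _ , _) = src e , tgt e , Pe

module _ (c : Pt n) (b : ℚ) where

  hull-slack : (ws : List (WEdge n)) → Σₗ coeff ws ≡ 1ℚ →
               (∀ u → x u ≡ Σₗ (λ e → coeff e * ε (src e) (tgt e) u) ws) →
               b - dot c x ≡ Σₗ (λ e → coeff e * slack c b (src e) (tgt e)) ws
  hull-slack {x} ws Σ≡1 x≗ = begin
    b - dot c x
      ≡⟨ cong₂ _-_ (sym (trans (cong (b *_) Σ≡1) (ℚP.*-identityʳ b)))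
                   (trans (dot-cong c x≗) (dot-Σₗ c coeff (λ e → ε (src e) (tgt e)) ws)) ⟩
    b * Σₗ coeff ws - Σₗ (λ e → coeff e * dot c (ε (src e) (tgt e))) ws
      ≡⟨ cong₂ _-_ (sym (Σₗ-*ˡ b ws)) (Σₗ-cong (All.universal (λ e → cong (coeff e *_) (dot-ε c _ _)) ws)) ⟩
    Σₗ (λ e → b * coeff e) ws - Σₗ (λ e → coeff e * (c (src e) - c (tgt e))) ws
      ≡⟨ Σₗ-− ws ⟨
    Σₗ (λ e → b * coeff e - coeff e * (c (src e) - c (tgt e))) ws
      ≡⟨ Σₗ-cong (All.universal (λ e → solve 3 (λ a b d → b :* a :- a :* d := a :* (b :- d))
                                                refl (coeff e) b (c (src e) - c (tgt e))) ws) ⟩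
    Σₗ (λ e → coeff e * slack c b (src e) (tgt e)) ws ∎
    where open ≡-Reasoning

  hull-≤ : (∀ {s t} → P s t → 0ℚ ≤ slack c b s t) → Hull P x → dot c x ≤ b
  hull-≤ slack≥0 (ws , ok , Σ≡1 , x≗) =
    0≤q-p⇒p≤q (subst (0ℚ ≤_) (sym (hull-slack ws Σ≡1 x≗))
                     (Σₗ-nonNeg (All.map (λ (0≤a , Pe) → nonNeg*nonNeg 0≤a (slack≥0 Pe)) ok)))

  hull-≡ : (∀ {s t} → P s t → slack c b s t ≡ 0ℚ) → Hull P x → dot c x ≡ b
  hull-≡ slack≡0 (ws , ok , Σ≡1 , x≗) = sym (ℚ+.x∙y⁻¹≈ε⇒x≈y b _
    (trans (hull-slack ws Σ≡1 x≗)
           (Σₗ-zero (All.map (λ { {e} (_ , Pe) → trans (cong (coeff e *_) (slack≡0 Pe)) (ℚP.*-zeroʳ (coeff e)) }) ok))))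

  hull-tight : (∀ {s t} → P s t → 0ℚ ≤ slack c b s t) → Hull P x → dot c x ≡ b →
               Hull (λ s t → P s t × slack c b s t ≡ 0ℚ) x
  hull-tight slack≥0 (ws , ok , Σ≡1 , x≗) dot≡b =
    filter tight? ws ,
    All.zipWith (λ ((0≤a , Pe) , tight) → 0≤a , Pe , tight) (AllP.filter⁺ tight? ok , AllP.all-filter tight? ws) ,
    trans (Σₗ-filter tight? dropped≡0) Σ≡1 ,
    λ u → trans (x≗ u) (sym (Σₗ-filter tight? (All.map (λ { {e} a≡0 ¬tight →
            trans (cong (_* ε (src e) (tgt e) u) (a≡0 ¬tight)) (ℚP.*-zeroˡ (ε (src e) (tgt e) u)) }) dropped≡0)))
    where
    tight? : Decidable (λ e → slack c b (src e) (tgt e) ≡ 0ℚ)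
    tight? e = slack c b (src e) (tgt e) ℚP.≟ 0ℚ
    products≡0 : All (λ e → coeff e * slack c b (src e) (tgt e) ≡ 0ℚ) ws
    products≡0 = Σₗ-nonNeg-≡0 (All.map (λ (0≤a , Pe) → nonNeg*nonNeg 0≤a (slack≥0 Pe)) ok)
                   (trans (sym (hull-slack ws Σ≡1 x≗)) (trans (cong (λ y → b - y) dot≡b) (ℚP.+-inverseʳ b)))
    dropped≡0 : All (λ e → ¬ slack c b (src e) (tgt e) ≡ 0ℚ → coeff e ≡ 0ℚ) ws
    dropped≡0 = All.map (λ product≡0 ¬tight → *-cancelʳ-≡0 ¬tight product≡0) products≡0

ε-value : {v w : Fin n} → v ≢ w → ∀ u →
          (u ≡ v × ε v w u ≡ 1ℚ) ⊎ (u ≡ w × ε v w u ≡ - 1ℚ) ⊎ ε v w u ≡ 0ℚ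
ε-value {v = v} {w} v≢w u with v FinP.≟ u | w FinP.≟ u
... | yes refl | yes refl = contradiction refl v≢w
... | yes refl | no _     = inj₁ (refl , refl)
... | no _     | yes refl = inj₂ (inj₁ (refl , refl))
... | no _     | no _     = inj₂ (inj₂ refl)

-- ε v w is the unique maximiser of ⟨ε v w , -⟩ among the ε s t, with maximum 2.
ε-slack : {v w : Fin n} → v ≢ w → ∀ s t →
          0ℚ ≤ slack (ε v w) (1ℚ + 1ℚ) s t × (slack (ε v w) (1ℚ + 1ℚ) s t ≡ 0ℚ → s ≡ v × t ≡ w)
ε-slack v≢w s t with ε-value v≢w s | ε-value v≢w t
... | inj₁ (_ , es)          | inj₁ (_ , et)          rewrite es | et = ℚP.nonNegative⁻¹ _ , λ ()
... | inj₁ (s≡v , es)        | inj₂ (inj₁ (t≡w , et)) rewrite es | et = ℚP.≤-refl , λ _ → s≡v , t≡w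
... | inj₁ (_ , es)          | inj₂ (inj₂ et)         rewrite es | et = ℚP.nonNegative⁻¹ _ , λ ()
... | inj₂ (inj₁ (_ , es))   | inj₁ (_ , et)          rewrite es | et = ℚP.nonNegative⁻¹ _ , λ ()
... | inj₂ (inj₁ (_ , es))   | inj₂ (inj₁ (_ , et))   rewrite es | et = ℚP.nonNegative⁻¹ _ , λ ()
... | inj₂ (inj₁ (_ , es))   | inj₂ (inj₂ et)         rewrite es | et = ℚP.nonNegative⁻¹ _ , λ ()
... | inj₂ (inj₂ es)         | inj₁ (_ , et)          rewrite es | et = ℚP.nonNegative⁻¹ _ , λ ()
... | inj₂ (inj₂ es)         | inj₂ (inj₁ (_ , et))   rewrite es | et = ℚP.nonNegative⁻¹ _ , λ ()
... | inj₂ (inj₂ es)         | inj₂ (inj₂ et)         rewrite es | et = ℚP.nonNegative⁻¹ _ , λ ()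

hull-vertex : {v w : Fin n} → v ≢ w → Hull P (ε v w) → P v w
hull-vertex {P = P} {v = v} {w} v≢w hull =
  attained (hull-inhabited (hull-tight (ε v w) 2ℚ (λ {s} {t} _ → proj₁ (ε-slack v≢w s t)) hull dot≡2))
  where
  2ℚ = 1ℚ + 1ℚ
  dot≡2 : dot (ε v w) (ε v w) ≡ 2ℚ
  dot≡2 = trans (dot-ε (ε v w) v w)
                (cong₂ _-_ (cong₂ _-_ (κ-diag v) (κ-off (v≢w ∘ sym))) (cong₂ _-_ (κ-off v≢w) (κ-diag w)))
  attained : ∃₂ (λ s t → P s t × slack (ε v w) 2ℚ s t ≡ 0ℚ) → P v w
  attained (s , t , Pst , tight) with refl , refl ← proj₂ (ε-slack v≢w s t) tight = Pst

edge⇒≢ : (Q : Quiver n) {s t : Fin n} → Edge Q s t → s ≢ t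
edge⇒≢ Q {s} Qss refl = subst T (noLoop Q s) Qss

module _ {Q R : Quiver n} (R⊆Q : LlufSubquiver R Q) (c : Pt n) (b : ℚ) where

  face-of-slack : (∀ {s t} → Edge R s t → slack c b s t ≡ 0ℚ) →
                  (∀ {s t} → Edge Q s t → ¬ Edge R s t → 0ℚ < slack c b s t) →
                  IsFace (DE R) (DE Q)
  face-of-slack slack≡0 slack>0 = c , b , (λ _ → hull-≤ c b slack≥0) , λ _ → mk⇔ into onto
    where
    slack≥0 : ∀ {s t} → Edge Q s t → 0ℚ ≤ slack c b s t
    slack≥0 {s} {t} Qst with T? (edge R s t)
    ... | yes Rst = ℚP.≤-reflexive (sym (slack≡0 Rst))
    ... | no ¬Rst = ℚP.<⇒≤ (slack>0 Qst ¬Rst)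
    tight⇒R : ∀ {s t} → Edge Q s t × slack c b s t ≡ 0ℚ → Edge R s t
    tight⇒R {s} {t} (Qst , tight) with T? (edge R s t)
    ... | yes Rst = Rst
    ... | no ¬Rst = contradiction (sym tight) (ℚP.<⇒≢ (slack>0 Qst ¬Rst))
    into : ∀ {x} → DE R x → DE Q x × dot c x ≡ b
    into h = hull-mono (R⊆Q _ _) h , hull-≡ c b slack≡0 h
    onto : ∀ {x} → DE Q x × dot c x ≡ b → DE R x
    onto (h , dot≡b) = hull-mono tight⇒R (hull-tight c b slack≥0 h dot≡b)

module _ {Q R : Quiver n} (c : Pt n) (b : ℚ)
         (valid : ∀ x → DE Q x → dot c x ≤ b) (face : ∀ x → DE R x ⇔ (DE Q x × dot c x ≡ b)) where

  face-dot : ∀ {x} → DE R x → dot c x ≡ b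
  face-dot {x} h = proj₂ (Equivalence.to (face x) h)

  face-slack-R : ∀ {s t} → Edge R s t → slack c b s t ≡ 0ℚ
  face-slack-R {s} {t} Rst = begin
    b - (c s - c t)       ≡⟨ cong (λ y → b - y) (dot-ε c s t) ⟨
    b - dot c (ε s t)     ≡⟨ cong (λ y → b - y) (face-dot (ε∈hull Rst)) ⟩
    b - b                 ≡⟨ ℚP.+-inverseʳ b ⟩
    0ℚ                    ∎
    where open ≡-Reasoning

  face-slack-nonR : ∀ {s t} → Edge Q s t → ¬ Edge R s t → 0ℚ < slack c b s t
  face-slack-nonR {s} {t} Qst ¬Rst = ≤∧≢⇒< slack≥0 (¬Rst ∘ hull-vertex (edge⇒≢ Q Qst) ∘ on-face)
    where
    ε≤b : c s - c t ≤ b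
    ε≤b = subst (_≤ b) (dot-ε c s t) (valid _ (ε∈hull Qst))
    slack≥0 : 0ℚ ≤ slack c b s t
    slack≥0 = p≤q⇒0≤q-p ε≤b
    on-face : 0ℚ ≡ slack c b s t → DE R (ε s t)
    on-face 0≡slack = Equivalence.from (face (ε s t))
      (ε∈hull Qst , trans (dot-ε c s t) (sym (ℚ+.x∙y⁻¹≈ε⇒x≈y b _ (sym 0≡slack))))

-- Affine independence in codimension one

cramer₂ : ∀ {a b c d x y} → a * x + b * y ≡ 0ℚ → c * x + d * y ≡ 0ℚ → a * d - b * c ≢ 0ℚ →
          x ≡ 0ℚ × y ≡ 0ℚ
cramer₂ {a} {b} {c} {d} {x} {y} row₁ row₂ det≢0 =
  *-cancelʳ-≡0 det≢0 (begin
    x * (a * d - b * c)                       ≡⟨ solve 6 (λ a b c d x y → x :* (a :* d :- b :* c) :=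
                                                   d :* (a :* x :+ b :* y) :- b :* (c :* x :+ d :* y))
                                                   refl a b c d x y ⟩
    d * (a * x + b * y) - b * (c * x + d * y) ≡⟨ cong₂ (λ r₁ r₂ → d * r₁ - b * r₂) row₁ row₂ ⟩
    d * 0ℚ - b * 0ℚ                           ≡⟨ solve 2 (λ b d → d :* con 0ℚ :- b :* con 0ℚ := con 0ℚ) refl b d ⟩
    0ℚ                                        ∎) ,
  *-cancelʳ-≡0 det≢0 (begin
    y * (a * d - b * c)                       ≡⟨ solve 6 (λ a b c d x y → y :* (a :* d :- b :* c) :=
                                                   a :* (c :* x :+ d :* y) :- c :* (a :* x :+ b :* y))
                                                   refl a b c d x y ⟩
    a * (c * x + d * y) - c * (a * x + b * y) ≡⟨ cong₂ (λ r₂ r₁ → a * r₂ - c * r₁) row₂ row₁ ⟩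
    a * 0ℚ - c * 0ℚ                           ≡⟨ solve 2 (λ a c → a :* con 0ℚ :- c :* con 0ℚ := con 0ℚ) refl a c ⟩
    0ℚ                                        ∎)
  where open ≡-Reasoning

dot-zipWith : (h : Pt n) (ls : List ℚ) (ps : List (Pt n)) →
              dot h (λ u → sumℚ (zipWith (λ l p → l * p u) ls ps)) ≡ sumℚ (zipWith (λ l p → l * dot h p) ls ps)
dot-zipWith h []       ps       = dot-zero h
dot-zipWith h (_ ∷ _)  []       = dot-zero h
dot-zipWith h (l ∷ ls) (p ∷ ps) =
  trans (dot-+ h (λ u → l * p u) (λ u → sumℚ (zipWith (λ l p → l * p u) ls ps)))
        (cong₂ _+_ (dot-* h l p) (dot-zipWith h ls ps))

sumℚ-zipWith-const : ∀ (h : Pt n) {K} (ls : List ℚ) (ps : List (Pt n)) → length ls ≡ length ps →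
                     All (λ p → dot h p ≡ K) ps → sumℚ (zipWith (λ l p → l * dot h p) ls ps) ≡ sumℚ ls * K
sumℚ-zipWith-const h {K} []       []       _   []         = sym (ℚP.*-zeroˡ K)
sumℚ-zipWith-const h {K} (l ∷ ls) (_ ∷ ps) len (hp ∷ hps) =
  trans (cong₂ (λ y z → l * y + z) hp (sumℚ-zipWith-const h ls ps (ℕP.suc-injective len) hps))
        (sym (ℚP.*-distribʳ-+ K l (sumℚ ls)))

module _ (g c : Pt n) (b : ℚ) {ps : List (Pt n)} (indep : AffinelyIndependent ps)
         (g≡0 : All (λ p → dot g p ≡ 0ℚ) ps) (c≡b : All (λ p → dot c p ≡ b) ps) where

  affinelyIndependent-∷₂ : ∀ {pe pf} → dot g pe * (b - dot c pf) - dot g pf * (b - dot c pe) ≢ 0ℚ →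
                           AffinelyIndependent (pe ∷ pf ∷ ps)
  affinelyIndependent-∷₂ {pe} {pf} det≢0 (α ∷ β ∷ ls) len Σ≡0 comb≡0 =
    α≡0 ∷ β≡0 ∷ indep ls len′ Σls≡0 combls≡0
    where
    open ≡-Reasoning
    len′ : length ls ≡ length ps
    len′ = ℕP.suc-injective (ℕP.suc-injective len)
    S = sumℚ ls
    C : Pt n
    C u = sumℚ (zipWith (λ l p → l * p u) ls ps)
    image : ∀ h {K} → All (λ p → dot h p ≡ K) ps → α * dot h pe + (β * dot h pf + S * K) ≡ 0ℚ
    image h {K} hps = begin
      α * dot h pe + (β * dot h pf + S * K)
        ≡⟨ cong (λ z → α * dot h pe + (β * dot h pf + z)) (sumℚ-zipWith-const h ls ps len′ hps) ⟨
      sumℚ (zipWith (λ l p → l * dot h p) (α ∷ β ∷ ls) (pe ∷ pf ∷ ps))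
        ≡⟨ dot-zipWith h (α ∷ β ∷ ls) (pe ∷ pf ∷ ps) ⟨
      dot h (λ u → α * pe u + (β * pf u + C u))       ≡⟨ dot-cong h comb≡0 ⟩
      dot h (λ _ → 0ℚ)                               ≡⟨ dot-zero h ⟩
      0ℚ                                             ∎
    row₁ : dot g pe * α + dot g pf * β ≡ 0ℚ
    row₁ = trans (solve 5 (λ α β Ge Gf S → Ge :* α :+ Gf :* β := α :* Ge :+ (β :* Gf :+ S :* con 0ℚ))
                          refl α β (dot g pe) (dot g pf) S)
                 (image g g≡0)
    row₂ : (b - dot c pe) * α + (b - dot c pf) * β ≡ 0ℚ
    row₂ = begin
      (b - dot c pe) * α + (b - dot c pf) * β
        ≡⟨ solve 6 (λ α β Ce Cf S b → (b :- Ce) :* α :+ (b :- Cf) :* β :=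
                      b :* (α :+ (β :+ S)) :- (α :* Ce :+ (β :* Cf :+ S :* b))) refl α β (dot c pe) (dot c pf) S b ⟩
      b * (α + (β + S)) - (α * dot c pe + (β * dot c pf + S * b))
        ≡⟨ cong₂ (λ z z′ → b * z - z′) Σ≡0 (image c c≡b) ⟩
      b * 0ℚ - 0ℚ                                    ≡⟨ solve 1 (λ b → b :* con 0ℚ :- con 0ℚ := con 0ℚ) refl b ⟩
      0ℚ                                             ∎
    α≡0 : α ≡ 0ℚ
    α≡0 = proj₁ (cramer₂ {dot g pe} {dot g pf} {b - dot c pe} {b - dot c pf} row₁ row₂ det≢0)
    β≡0 : β ≡ 0ℚ
    β≡0 = proj₂ (cramer₂ {dot g pe} {dot g pf} {b - dot c pe} {b - dot c pf} row₁ row₂ det≢0)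
    Σls≡0 : S ≡ 0ℚ
    Σls≡0 = begin
      S                    ≡⟨ solve 1 (λ S → S := con 0ℚ :+ (con 0ℚ :+ S)) refl S ⟩
      0ℚ + (0ℚ + S)        ≡⟨ cong₂ (λ a a′ → a + (a′ + S)) α≡0 β≡0 ⟨
      α + (β + S)          ≡⟨ Σ≡0 ⟩
      0ℚ                   ∎
    combls≡0 : ∀ u → C u ≡ 0ℚ
    combls≡0 u = begin
      C u                                  ≡⟨ solve 3 (λ a a′ z → z := con 0ℚ :* a :+ (con 0ℚ :* a′ :+ z))
                                                       refl (pe u) (pf u) (C u) ⟩
      0ℚ * pe u + (0ℚ * pf u + C u)        ≡⟨ cong₂ (λ a a′ → a * pe u + (a′ * pf u + C u)) α≡0 β≡0 ⟨
      α * pe u + (β * pf u + C u)          ≡⟨ comb≡0 u ⟩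
      0ℚ                                   ∎

i-1+1≡i : ∀ i → (i ℤ.- 1ℤ) ℤ.+ 1ℤ ≡ i
i-1+1≡i i = trans (ℤP.+-assoc i (ℤ.- 1ℤ) 1ℤ) (ℤP.+-identityʳ i)

i+1≰i : ∀ i → ¬ (i ℤ.+ 1ℤ ℤ.≤ i)
i+1≰i i i+1≤i = ℤP.≤⇒≯ i+1≤i (subst (ℤ._< i ℤ.+ 1ℤ) (ℤP.+-identityʳ i) (ℤP.+-monoʳ-< i (ℤ.+<+ (ℕ.s≤s ℕ.z≤n))))

module _ {S T : Pt n → Set} {d : ℤ} (dimT : HasDim T d) (dimS : HasDim S (d ℤ.- 1ℤ)) where

  codim-one-proper : ¬ (∀ {x} → T x → S x)
  codim-one-proper T⊆S with qs , Tqs , indep , len ← proj₁ dimT =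
    i+1≰i d (subst₂ ℤ._≤_ len (i-1+1≡i d) (proj₂ dimS qs (All.map T⊆S Tqs) indep))

  -- Adding two points of T to a maximal independent family of S would exceed dim T.
  codim-one-rigid : (∀ {x} → S x → T x) → (g c : Pt n) (b : ℚ) →
                    (∀ {x} → S x → dot g x ≡ 0ℚ) → (∀ {x} → S x → dot c x ≡ b) →
                    ∀ {pe pf} → T pe → T pf → dot g pe * (b - dot c pf) ≡ dot g pf * (b - dot c pe)
  codim-one-rigid S⊆T g c b g≡0 c≡b {pe} {pf} Tpe Tpf
    with dot g pe * (b - dot c pf) - dot g pf * (b - dot c pe) ℚP.≟ 0ℚ
  ... | yes det≡0 = ℚ+.x∙y⁻¹≈ε⇒x≈y _ _ det≡0
  ... | no det≢0 with ps , Sps , indep , len ← proj₁ dimS =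
    contradiction (proj₂ dimT (pe ∷ pf ∷ ps) (Tpe ∷ Tpf ∷ All.map S⊆T Sps)
                    (affinelyIndependent-∷₂ g c b indep (All.map g≡0 Sps) (All.map c≡b Sps) det≢0))
                  (two-too-many (trans len (i-1+1≡i d)))
    where
    two-too-many : ∀ {m} → ℤ.+ m ≡ d → ¬ (ℤ.+ ℕ.suc (ℕ.suc m) ℤ.≤ d ℤ.+ 1ℤ)
    two-too-many {m} refl m+2≤m+1 = ℕP.1+n≰n (subst (ℕ.suc (ℕ.suc m) ℕ.≤_) (ℕP.+-comm m 1) (ℤP.drop‿+≤+ m+2≤m+1))

-- Counting components

surjective⇒≤ : ∀ {m k} {f : Fin m → Fin k} → Surjective _≡_ _≡_ f → k ℕ.≤ m
surjective⇒≤ {m} {k} {f} surj = FinP.injective⇒≤ {f = section} section-injective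
  where
  section : Fin k → Fin m
  section y = proj₁ (surj y)
  section-injective : Injective _≡_ _≡_ section
  section-injective {y} {y′} eq = trans (sym (proj₂ (surj y) refl)) (trans (cong f eq) (proj₂ (surj y′) refl))

surjective-punchIn : ∀ {m k} {f : Fin (ℕ.suc m) → Fin k} → Surjective _≡_ _≡_ f →
                     ∀ {i j} → i ≢ j → f i ≡ f j → Surjective _≡_ _≡_ (f ∘ punchIn i)
surjective-punchIn {f = f} surj {i} {j} i≢j fi≡fj y with surj y
... | x , fx≡y with i FinP.≟ x
...   | yes refl = punchOut i≢j ,
                   λ { refl → trans (cong f (FinP.punchIn-punchOut i≢j)) (trans (sym fi≡fj) (fx≡y refl)) }
...   | no i≢x   = punchOut i≢x , λ { refl → trans (cong f (FinP.punchIn-punchOut i≢x)) (fx≡y refl) }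

collision⇒< : ∀ {m k} {f : Fin m → Fin k} → Surjective _≡_ _≡_ f → ∀ {i j} → i ≢ j → f i ≡ f j → k ℕ.< m
collision⇒< {m = ℕ.suc m} surj i≢j fi≡fj = ℕ.s≤s (surjective⇒≤ (surjective-punchIn surj i≢j fi≡fj))

two-collisions⇒< : ∀ {m k} {f : Fin m → Fin k} → Surjective _≡_ _≡_ f →
                   ∀ {i j i′ j′} → i ≢ j → f i ≡ f j → i′ ≢ j′ → f i′ ≡ f j′ → i ≢ i′ → i ≢ j′ →
                   ℕ.suc k ℕ.< m
two-collisions⇒< {m = ℕ.suc m} {f = f} surj {i} i≢j fi≡fj i′≢j′ fi′≡fj′ i≢i′ i≢j′ =
  ℕ.s≤s (collision⇒< (surjective-punchIn surj i≢j fi≡fj)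
                     (i′≢j′ ∘ FinP.punchOut-injective i≢i′ i≢j′)
                     (trans (cong f (FinP.punchIn-punchOut i≢i′))
                            (trans fi′≡fj′ (sym (cong f (FinP.punchIn-punchOut i≢j′))))))

-- Two collisions avoiding i would force m ≥ k + 2.
collision-unique : ∀ {m k} {f : Fin m → Fin k} → Surjective _≡_ _≡_ f → m ℕ.≤ ℕ.suc k →
                   ∀ {i j a b} → i ≢ j → f i ≡ f j → a ≢ b → f a ≡ f b → a ≡ i ⊎ b ≡ i
collision-unique surj m≤1+k {i} {j} {a} {b} i≢j fi≡fj a≢b fa≡fb with a FinP.≟ i | b FinP.≟ i
... | yes a≡i | _        = inj₁ a≡i
... | no _    | yes b≡i  = inj₂ b≡i
... | no a≢i  | no b≢i   =
  contradiction (ℕP.<-≤-trans (two-collisions⇒< surj i≢j fi≡fj a≢b fa≡fb (a≢i ∘ sym) (b≢i ∘ sym)) m≤1+k)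
                (ℕP.<-irrefl refl)

-- Rank functions

defect : (Fin n → ℚ) → Fin n → Fin n → ℚ
defect ρ v w = ρ v - ρ w + 1ℚ

rank⇔defect≡0 : (ρ : Fin n → ℚ) (v w : Fin n) → ρ v + 1ℚ ≡ ρ w ⇔ defect ρ v w ≡ 0ℚ
rank⇔defect≡0 ρ v w = mk⇔
  (λ rank → trans shift (trans (cong (_- ρ w) rank) (ℚP.+-inverseʳ (ρ w))))
  (λ defect≡0 → ℚ+.x∙y⁻¹≈ε⇒x≈y (ρ v + 1ℚ) (ρ w) (trans (sym shift) defect≡0))
  where
  shift : defect ρ v w ≡ ρ v + 1ℚ - ρ w
  shift = solve 2 (λ x y → x :- y :+ con 1ℚ := x :+ con 1ℚ :- y) refl (ρ v) (ρ w)

slack-of-scaled-rank : (ρ : Fin n → ℚ) (τ : ℚ) (x y : Fin n) →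
                       slack (λ u → - (τ * ρ u)) τ x y ≡ τ * defect ρ x y
slack-of-scaled-rank ρ τ x y =
  solve 3 (λ τ a b → τ :- (:- (τ :* a) :- :- (τ :* b)) := τ :* (a :- b :+ con 1ℚ)) refl τ (ρ x) (ρ y)

defect-of-scaled-slack : (c : Pt n) (b : ℚ) .{{_ : ℚ.NonZero b}} (x y : Fin n) →
                         defect (λ u → - (c u * 1/ b)) x y ≡ slack c b x y * 1/ b
defect-of-scaled-slack c b x y = begin
  - (c x * 1/ b) - - (c y * 1/ b) + 1ℚ
    ≡⟨ cong (- (c x * 1/ b) - - (c y * 1/ b) +_) (ℚP.*-inverseʳ b) ⟨
  - (c x * 1/ b) - - (c y * 1/ b) + b * 1/ b
    ≡⟨ solve 4 (λ a a′ b r → :- (a :* r) :- :- (a′ :* r) :+ b :* r := (b :- (a :- a′)) :* r) refl (c x) (c y) b (1/ b) ⟩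
  slack c b x y * 1/ b ∎
  where open ≡-Reasoning

edge-outside? : (Q R : Quiver n) (x y : Fin n) → Dec (Edge Q x y × ¬ Edge R x y)
edge-outside? Q R x y = T? (edge Q x y) ×-dec ¬? (T? (edge R x y))

edges-outside? : (Q R : Quiver n) → Dec (∃₂ λ x y → Edge Q x y × ¬ Edge R x y)
edges-outside? Q R = FinP.any? λ x → FinP.any? λ y → edge-outside? Q R x y

module _ {Q R : Quiver n} (R⊆Q : LlufSubquiver R Q) (ρ : Fin n → ℚ) (rank : IsRankFunction R ρ) where

  scaled-rank-face : (τ : ℚ) → (∀ {x y} → Edge Q x y → ¬ Edge R x y → 0ℚ < τ * defect ρ x y) →
                     IsFace (DE R) (DE Q)
  scaled-rank-face τ τ-positive = face-of-slack {Q = Q} {R} R⊆Q (λ u → - (τ * ρ u)) τ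
    (λ {x} {y} Rxy → trans (slack-of-scaled-rank ρ τ x y)
                           (trans (cong (τ *_) (Equivalence.to (rank⇔defect≡0 ρ x y) (rank x y Rxy))) (ℚP.*-zeroʳ τ)))
    (λ {x} {y} Qxy ¬Rxy → subst (0ℚ <_) (sym (slack-of-scaled-rank ρ τ x y)) (τ-positive Qxy ¬Rxy))

condition2⇒face : {Q R : Quiver n} → LlufSubquiver R Q → ∀ {k l} → Condition2 Q R k l → IsFace (DE R) (DE Q)
condition2⇒face {Q = Q} {R} R⊆Q (_ , ρ , rank , positive) with edges-outside? Q R
... | no none = scaled-rank-face {Q = Q} {R} R⊆Q ρ rank 1ℚ (λ Qxy ¬Rxy → contradiction (_ , _ , Qxy , ¬Rxy) none)
... | yes (v , w , Qvw , ¬Rvw) = scaled-rank-face {Q = Q} {R} R⊆Q ρ rank (defect ρ v w) (positive v w _ _ Qvw ¬Rvw)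

-- Components of R inside Q

walk-invariant : {X : Quiver n} (h : Fin n → A) → (∀ {a b} → Edge X a b → h a ≡ h b) →
                 ∀ {x y} → Walk X x y → h x ≡ h y
walk-invariant h inv here        = refl
walk-invariant h inv (fwd Xvu p) = trans (inv Xvu) (walk-invariant h inv p)
walk-invariant h inv (bwd Xuv p) = trans (sym (inv Xuv)) (walk-invariant h inv p)

walk-mono : {Q R : Quiver n} → LlufSubquiver R Q → ∀ {x y} → Walk R x y → Walk Q x y
walk-mono R⊆Q here        = here
walk-mono R⊆Q (fwd Rvu p) = fwd (R⊆Q _ _ Rvu) (walk-mono R⊆Q p)
walk-mono R⊆Q (bwd Ruv p) = bwd (R⊆Q _ _ Ruv) (walk-mono R⊆Q p)

module Components {Q R : Quiver n} (R⊆Q : LlufSubquiver R Q) {k l : ℕ}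
                  (πQ : NumComponents Q k) (πR : NumComponents R l) where

  [_]Q : Fin n → Fin k
  [_]Q = proj₁ πQ

  [_] : Fin n → Fin l
  [_] = proj₁ πR

  connected⇒[]≡ : ∀ {x y} → Connected R x y → [ x ] ≡ [ y ]
  connected⇒[]≡ {x} {y} = Equivalence.from (proj₂ (proj₂ πR) x y)

  []≡⇒connected : ∀ {x y} → [ x ] ≡ [ y ] → Connected R x y
  []≡⇒connected {x} {y} = Equivalence.to (proj₂ (proj₂ πR) x y)

  R-edge⇒[]≡ : ∀ {x y} → Edge R x y → [ x ] ≡ [ y ]
  R-edge⇒[]≡ Rxy = connected⇒[]≡ (fwd Rxy here)

  representative : Fin l → Fin n
  representative C = proj₁ (proj₁ (proj₂ πR) C)

  [representative] : ∀ C → [ representative C ] ≡ C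
  [representative] C = proj₂ (proj₁ (proj₂ πR) C) refl

  φ : Fin l → Fin k
  φ C = [ representative C ]Q

  φ-[] : ∀ x → φ [ x ] ≡ [ x ]Q
  φ-[] x = Equivalence.from (proj₂ (proj₂ πQ) _ x) (walk-mono R⊆Q ([]≡⇒connected ([representative] [ x ])))

  φ-surjective : Surjective _≡_ _≡_ φ
  φ-surjective j = [ v ] , λ { refl → trans (φ-[] v) (proj₂ (proj₁ (proj₂ πQ) j) refl) }
    where
    v : Fin n
    v = proj₁ (proj₁ (proj₂ πQ) j)

  φ-edge : ∀ {x y} → Edge Q x y → φ [ x ] ≡ φ [ y ]
  φ-edge {x} {y} Qxy = trans (φ-[] x) (trans (Equivalence.from (proj₂ (proj₂ πQ) x y) (fwd Qxy here)) (sym (φ-[] y)))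

  φ-factors : (h : Fin l → A) → (∀ {x y} → Edge Q x y → h [ x ] ≡ h [ y ]) → ∀ {C C′} → φ C ≡ φ C′ → h C ≡ h C′
  φ-factors h inv {C} {C′} φC≡φC′ = begin
    h C                        ≡⟨ cong h ([representative] C) ⟨
    h [ representative C ]     ≡⟨ walk-invariant (h ∘ [_]) inv (Equivalence.to (proj₂ (proj₂ πQ) _ _) φC≡φC′) ⟩
    h [ representative C′ ]    ≡⟨ cong h ([representative] C′) ⟩
    h C′                       ∎
    where open ≡-Reasoning

  Q-edge⇒[]≡ : (∀ {x y} → Edge Q x y → ¬ Edge R x y → [ x ] ≡ [ y ]) → ∀ {x y} → Edge Q x y → [ x ] ≡ [ y ]
  Q-edge⇒[]≡ inner {x} {y} Qxy with T? (edge R x y)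
  ... | yes Rxy = R-edge⇒[]≡ Rxy
  ... | no ¬Rxy = inner Qxy ¬Rxy

  components-≡ : (∀ {x y} → Edge Q x y → ¬ Edge R x y → [ x ] ≡ [ y ]) → l ≡ k
  components-≡ inner =
    ℕP.≤-antisym (FinP.injective⇒≤ (φ-factors (λ C → C) (Q-edge⇒[]≡ inner))) (surjective⇒≤ φ-surjective)

  components-suc : ∀ {v w} → Edge Q v w → [ v ] ≢ [ w ] →
                   (∀ {x y} → Edge Q x y → ¬ Edge R x y → [ x ] ≡ [ v ] × [ y ] ≡ [ w ]) → l ≡ ℕ.suc k
  components-suc {v} {w} Qvw [v]≢[w] v→w =
    ℕP.≤-antisym (FinP.injective⇒≤ {f = λ C → ψ C (C FinP.≟ [ w ])} (ψ-injective _ _))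
                 (collision⇒< φ-surjective [v]≢[w] (φ-edge Qvw))
    where
    merge : Fin l → Fin l
    merge C with C FinP.≟ [ w ]
    ... | yes _ = [ v ]
    ... | no _  = C
    merge-[w] : merge [ w ] ≡ [ v ]
    merge-[w] with [ w ] FinP.≟ [ w ]
    ... | yes _       = refl
    ... | no [w]≢[w]  = contradiction refl [w]≢[w]
    merge-off : ∀ {C} → C ≢ [ w ] → merge C ≡ C
    merge-off {C} C≢[w] with C FinP.≟ [ w ]
    ... | yes C≡[w] = contradiction C≡[w] C≢[w]
    ... | no _      = refl
    merge-invariant : ∀ {x y} → Edge Q x y → merge [ x ] ≡ merge [ y ]
    merge-invariant {x} {y} Qxy with T? (edge R x y)
    ... | yes Rxy = cong merge (R-edge⇒[]≡ Rxy)
    ... | no ¬Rxy with [x]≡[v] , [y]≡[w] ← v→w Qxy ¬Rxy =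
      trans (cong merge [x]≡[v]) (trans (merge-off [v]≢[w]) (sym (trans (cong merge [y]≡[w]) merge-[w])))
    ψ : (C : Fin l) → Dec (C ≡ [ w ]) → Fin (ℕ.suc k)
    ψ C (yes _) = zero
    ψ C (no _)  = suc (φ C)
    ψ-injective : ∀ {C C′} (d : Dec (C ≡ [ w ])) (d′ : Dec (C′ ≡ [ w ])) → ψ C d ≡ ψ C′ d′ → C ≡ C′
    ψ-injective (yes C≡[w]) (yes C′≡[w]) _  = trans C≡[w] (sym C′≡[w])
    ψ-injective (no C≢[w])  (no C′≢[w])  eq =
      trans (sym (merge-off C≢[w])) (trans (φ-factors merge merge-invariant (FinP.suc-injective eq)) (merge-off C′≢[w]))

  crossing? : Dec (∃₂ λ x y → (Edge Q x y × ¬ Edge R x y) × [ x ] ≢ [ y ])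
  crossing? = FinP.any? λ x → FinP.any? λ y → edge-outside? Q R x y ×-dec ¬? ([ x ] FinP.≟ [ y ])

  indicator : Fin l → Pt n
  indicator C u = κ C [ u ]

  indicator-slack-R : ∀ C {x y} → Edge R x y → slack (indicator C) 0ℚ x y ≡ 0ℚ
  indicator-slack-R C {x} {y} Rxy rewrite R-edge⇒[]≡ Rxy =
    cong (λ z → 0ℚ - z) (ℚP.+-inverseʳ (indicator C y))

  indicator-pos : ∀ {C x y} → 0ℚ < indicator C x - indicator C y → [ x ] ≡ C
  indicator-pos {C} {x} {y} 0<diff with κ-cases C [ x ] | κ-cases C [ y ]
  ... | inj₁ (C≡[x] , _) | _            = sym C≡[x]
  ... | inj₂ (_ , gx≡0)  | inj₁ (_ , gy≡1) =
    contradiction (ℚP.negative⁻¹ _) (ℚP.<-asym (subst (0ℚ <_) (cong₂ _-_ gx≡0 gy≡1) 0<diff))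
  ... | inj₂ (_ , gx≡0)  | inj₂ (_ , gy≡0) =
    contradiction (subst (0ℚ <_) (cong₂ _-_ gx≡0 gy≡0) 0<diff) (ℚP.<-irrefl refl)

  indicator-neg : ∀ {C x y} → indicator C x - indicator C y < 0ℚ → [ y ] ≡ C
  indicator-neg {C} {x} {y} diff<0 with κ-cases C [ x ] | κ-cases C [ y ]
  ... | _               | inj₁ (C≡[y] , _) = sym C≡[y]
  ... | inj₁ (_ , gx≡1) | inj₂ (_ , gy≡0)  =
    contradiction (ℚP.positive⁻¹ _) (ℚP.<-asym (subst (_< 0ℚ) (cong₂ _-_ gx≡1 gy≡0) diff<0))
  ... | inj₂ (_ , gx≡0) | inj₂ (_ , gy≡0)  =
    contradiction (subst (_< 0ℚ) (cong₂ _-_ gx≡0 gy≡0) diff<0) (ℚP.<-irrefl refl)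

  -- As l = k + 1, all collisions of φ involve [ v ] and [ w ], so every edge of Q ∖ R runs from
  -- [ v ] to [ w ] (the reverse direction would close a cycle in Q/R).
  condition1⇒face : Condition1 Q R k l → IsFace (DE R) (DE Q)
  condition1⇒face (l≡1+k , full , acyclic) with edges-outside? Q R
  ... | no none =
    contradiction (trans (sym l≡1+k) (components-≡ λ Qxy ¬Rxy → contradiction (_ , _ , Qxy , ¬Rxy) none)) ℕP.1+n≢n
  ... | yes (v , w , Qvw , ¬Rvw) =
    face-of-slack {Q = Q} {R} R⊆Q (indicator [ w ]) 0ℚ (λ {x} {y} → indicator-slack-R [ w ] {x} {y}) slack>0
    where
    separated : ∀ {x y} → Edge Q x y → ¬ Edge R x y → [ x ] ≢ [ y ]
    separated Qxy ¬Rxy [x]≡[y] = ¬Rxy (full _ _ Qxy ([]≡⇒connected [x]≡[y]))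
    shares : ∀ {i j x y} → i ≢ j → φ i ≡ φ j → Edge Q x y → ¬ Edge R x y → [ x ] ≡ i ⊎ [ y ] ≡ i
    shares i≢j φi≡φj Qxy ¬Rxy =
      collision-unique φ-surjective (ℕP.≤-reflexive l≡1+k) i≢j φi≡φj (separated Qxy ¬Rxy) (φ-edge Qxy)
    v→w : ∀ {x y} → Edge Q x y → ¬ Edge R x y → [ x ] ≡ [ v ] × [ y ] ≡ [ w ]
    v→w {x} {y} Qxy ¬Rxy with shares (separated Qvw ¬Rvw) (φ-edge Qvw) Qxy ¬Rxy
                            | shares (separated Qvw ¬Rvw ∘ sym) (sym (φ-edge Qvw)) Qxy ¬Rxy
    ... | inj₁ [x]≡[v] | inj₁ [x]≡[w] = contradiction (trans (sym [x]≡[v]) [x]≡[w]) (separated Qvw ¬Rvw)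
    ... | inj₁ [x]≡[v] | inj₂ [y]≡[w] = [x]≡[v] , [y]≡[w]
    ... | inj₂ [y]≡[v] | inj₁ [x]≡[w] =
      contradiction ([]≡⇒connected [y]≡[v])
        (acyclic v y 2 (ℕ.s≤s (ℕ.s≤s ℕ.z≤n))
          (step (v , w , Qvw , ¬Rvw , here , here)
            (step (x , y , Qxy , ¬Rxy , []≡⇒connected (sym [x]≡[w]) , here) stop)))
    ... | inj₂ [y]≡[v] | inj₂ [y]≡[w] = contradiction (trans (sym [y]≡[v]) [y]≡[w]) (separated Qvw ¬Rvw)
    slack>0 : ∀ {x y} → Edge Q x y → ¬ Edge R x y → 0ℚ < slack (indicator [ w ]) 0ℚ x y
    slack>0 {x} {y} Qxy ¬Rxy with [x]≡[v] , [y]≡[w] ← v→w Qxy ¬Rxy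
      rewrite κ-off {v = [ w ]} {[ x ]} (λ [w]≡[x] → separated Qvw ¬Rvw (sym (trans [w]≡[x] [x]≡[v])))
            | [y]≡[w] | κ-diag [ w ] = ℚP.positive⁻¹ _

  module _ {d : ℤ} (dimQ : HasDim (DE Q) d) (dimR : HasDim (DE R) (d ℤ.- 1ℤ))
           (c : Pt n) (b : ℚ) (valid : ∀ x → DE Q x → dot c x ≤ b)
           (face : ∀ x → DE R x ⇔ (DE Q x × dot c x ≡ b)) where

    private
      slack-R : ∀ {s t} → Edge R s t → slack c b s t ≡ 0ℚ
      slack-R = face-slack-R {Q = Q} {R} c b valid face

      slack>0 : ∀ {s t} → Edge Q s t → ¬ Edge R s t → 0ℚ < slack c b s t
      slack>0 = face-slack-nonR {Q = Q} {R} c b valid face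

    indicator-rigid : ∀ C {v w x y} → Edge Q v w → Edge Q x y →
      (indicator C v - indicator C w) * slack c b x y ≡ (indicator C x - indicator C y) * slack c b v w
    indicator-rigid C {v} {w} {x} {y} Qvw Qxy = begin
      (g v - g w) * slack c b x y           ≡⟨ cong₂ (λ p q → p * (b - q)) (dot-ε g v w) (dot-ε c x y) ⟨
      dot g (ε v w) * (b - dot c (ε x y))   ≡⟨ codim-one-rigid {d = d} dimQ dimR (hull-mono (R⊆Q _ _)) g c b
                                                 (hull-≡ g 0ℚ (indicator-slack-R C)) (face-dot {Q = Q} {R} c b valid face)
                                                 (ε∈hull Qvw) (ε∈hull Qxy) ⟩
      dot g (ε x y) * (b - dot c (ε v w))   ≡⟨ cong₂ (λ p q → p * (b - q)) (dot-ε g x y) (dot-ε c v w) ⟩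
      (g x - g y) * slack c b v w           ∎
      where
      open ≡-Reasoning
      g = indicator C

    module Crossing {v w : Fin n} (Qvw : Edge Q v w) (¬Rvw : ¬ Edge R v w) ([v]≢[w] : [ v ] ≢ [ w ]) where

      source : ∀ {x y} → Edge Q x y → ¬ Edge R x y → [ x ] ≡ [ v ]
      source {x} {y} Qxy ¬Rxy =
        indicator-pos (pos-factor (slack>0 Qvw ¬Rvw) (subst (0ℚ <_) (indicator-rigid [ v ] Qvw Qxy) lhs>0))
        where
        lhs>0 : 0ℚ < (indicator [ v ] v - indicator [ v ] w) * slack c b x y
        lhs>0 rewrite κ-diag [ v ] | κ-off [v]≢[w] = subst (0ℚ <_) (sym (ℚP.*-identityˡ _)) (slack>0 Qxy ¬Rxy)

      target : ∀ {x y} → Edge Q x y → ¬ Edge R x y → [ y ] ≡ [ w ]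
      target {x} {y} Qxy ¬Rxy =
        indicator-neg (neg-factor (slack>0 Qvw ¬Rvw) (subst (_< 0ℚ) (indicator-rigid [ w ] Qvw Qxy) lhs<0))
        where
        lhs<0 : (indicator [ w ] v - indicator [ w ] w) * slack c b x y < 0ℚ
        lhs<0 rewrite κ-diag [ w ] | κ-off ([v]≢[w] ∘ sym) =
          subst (_< 0ℚ) (solve 1 (λ s → :- s := (con 0ℚ :- con 1ℚ) :* s) refl (slack c b x y))
                (ℚP.neg-antimono-< (slack>0 Qxy ¬Rxy))

      condition1 : Condition1 Q R k l
      condition1 = components-suc Qvw [v]≢[w] (λ Qxy ¬Rxy → source Qxy ¬Rxy , target Qxy ¬Rxy) , full , acyclic
        where
        full : ComponentsFull Q R
        full x y Qxy x~y with T? (edge R x y)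
        ... | yes Rxy = Rxy
        ... | no ¬Rxy =
          contradiction (trans (sym (source Qxy ¬Rxy)) (trans (connected⇒[]≡ x~y) (target Qxy ¬Rxy))) [v]≢[w]
        acyclic : ContractionAcyclic Q R
        acyclic _ _ _ (ℕ.s≤s (ℕ.s≤s _)) (step (_ , _ , Q₁ , ¬R₁ , _ , w₁~a) (step (_ , _ , Q₂ , ¬R₂ , a~v₂ , _) _)) _ =
          [v]≢[w] (trans (sym (source Q₂ ¬R₂))
                  (trans (sym (connected⇒[]≡ a~v₂)) (trans (sym (connected⇒[]≡ w₁~a)) (target Q₁ ¬R₁))))

    module Inner (inner : ∀ {x y} → Edge Q x y → ¬ Edge R x y → [ x ] ≡ [ y ]) where

      b≢0 : b ≢ 0ℚ
      b≢0 b≡0 with edges-outside? Q R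
      ... | no none = codim-one-proper {d = d} dimQ dimR (hull-mono Q⇒R)
        where
        Q⇒R : ∀ {s t} → Edge Q s t → Edge R s t
        Q⇒R {s} {t} Qst with T? (edge R s t)
        ... | yes Rst = Rst
        ... | no ¬Rst = contradiction (s , t , Qst , ¬Rst) none
      ... | yes (x , y , Qxy , ¬Rxy) = ℚP.<-irrefl (sym slack≡0) (slack>0 Qxy ¬Rxy)
        where
        R-level : ∀ {s t} → Edge R s t → c s ≡ c t
        R-level Rst = ℚ+.x∙y⁻¹≈ε⇒x≈y _ _ (trans (sym (ℚ+.x∙y⁻¹≈ε⇒x≈y b _ (slack-R Rst))) b≡0)
        cx≡cy : c x ≡ c y
        cx≡cy = walk-invariant c R-level ([]≡⇒connected (inner Qxy ¬Rxy))
        slack≡0 : slack c b x y ≡ 0ℚ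
        slack≡0 = trans (cong₂ (λ b′ z → b′ - (z - c y)) b≡0 cx≡cy) (cong (λ z → 0ℚ - z) (ℚP.+-inverseʳ (c y)))

      -- ρ = - c / b turns the face equation c(s) - c(t) = b on R into ρ(s) + 1 = ρ(t).
      condition2 : Condition2 Q R k l
      condition2 = components-≡ inner , ρ , rank , positive
        where
        instance _ = ℚ.≢-nonZero b≢0
        ρ : Fin n → ℚ
        ρ u = - (c u * 1/ b)
        rank : IsRankFunction R ρ
        rank s t Rst = Equivalence.from (rank⇔defect≡0 ρ s t)
          (trans (defect-of-scaled-slack c b s t) (trans (cong (_* 1/ b) (slack-R Rst)) (ℚP.*-zeroˡ (1/ b))))
        1/b≢0 : 1/ b ≢ 0ℚ
        1/b≢0 1/b≡0 = contradiction (trans (sym (ℚP.*-inverseʳ b)) (trans (cong (b *_) 1/b≡0) (ℚP.*-zeroʳ b))) λ ()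
        positive : ∀ v w v′ w′ → Edge Q v w → ¬ Edge R v w → Edge Q v′ w′ → ¬ Edge R v′ w′ →
                   0ℚ < defect ρ v w * defect ρ v′ w′
        positive v w v′ w′ Qvw ¬Rvw Qv′w′ ¬Rv′w′ = subst (0ℚ <_) (sym product)
          (pos*pos (pos*pos (slack>0 Qvw ¬Rvw) (slack>0 Qv′w′ ¬Rv′w′)) (square-pos 1/b≢0))
          where
          product : defect ρ v w * defect ρ v′ w′ ≡ slack c b v w * slack c b v′ w′ * (1/ b * 1/ b)
          product = trans (cong₂ _*_ (defect-of-scaled-slack c b v w) (defect-of-scaled-slack c b v′ w′))
                          (solve 3 (λ s s′ r → s :* r :* (s′ :* r) := s :* s′ :* (r :* r))
                                   refl (slack c b v w) (slack c b v′ w′) (1/ b))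

    face⇒conditions : Condition1 Q R k l ⊎ Condition2 Q R k l
    face⇒conditions with crossing?
    ... | yes (v , w , (Qvw , ¬Rvw) , [v]≢[w]) = inj₁ (Crossing.condition1 Qvw ¬Rvw [v]≢[w])
    ... | no no-crossing = inj₂ (Inner.condition2 inner)
      where
      inner : ∀ {x y} → Edge Q x y → ¬ Edge R x y → [ x ] ≡ [ y ]
      inner {x} {y} Qxy ¬Rxy with [ x ] FinP.≟ [ y ]
      ... | yes [x]≡[y] = [x]≡[y]
      ... | no [x]≢[y]  = contradiction (x , y , (Qxy , ¬Rxy) , [x]≢[y]) no-crossing

theorem1p2 : ∀ {n} (Q R : Quiver n) → LlufSubquiver R Q →
    (k l : ℕ) → NumComponents Q k → NumComponents R l →
    (Σ ℤ λ d → HasDim (DE Q) d × HasDim (DE R) (d ℤ.- 1ℤ)) →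
    IsFacet (DE R) (DE Q) ⇔ (Condition1 Q R k l ⊎ Condition2 Q R k l)
theorem1p2 Q R R⊆Q k l πQ πR (d , dimQ , dimR) = mk⇔
  (λ ((c , b , valid , face) , _) → face⇒conditions {d = d} dimQ dimR c b valid face)
  (λ conditions → [ condition1⇒face , condition2⇒face {Q = Q} {R} R⊆Q ]′ conditions , d , dimQ , dimR)
  where open Components {Q = Q} {R} R⊆Q πQ πR
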